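{- For all integers $r\geq 2$ and $n\geq 1$, $M_r(n)\leq M_{r+1}(n+1)$.
   Context: The $K_r$-process on $n$ vertices from starting graph $G_0\subseteq K_n$: $G_t=G_{t-1}\cup\{e\in E(K_n): e \text{ completes a new copy of } K_r \text{ in } G_{t-1}\cup\{e\}\}$. $M_r(n)$ is the maximum over all starting graphs $G_0\subseteq K_n$ of the largest $t$ with $G_t\neq G_{t-1}$. -}

module Defs where

open import Data.Nat using (ℕ; zero; suc; _≤_; _<_; _≥_)
open import Data.Fin using (Fin)
open import Data.Product using (Σ; ∃; _×_; _,_)
open import Data.Sum using (_⊎_)
open import Data.Empty using (⊥)
open import Relation.Nullary using (¬_)
open import Relation.Binary.PropositionalEquality using (_≡_; _≢_)
open import Function.Definitions using (Injective)
open import Function.Bundles using (_⇔_)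

Graph : ℕ → Set₁
Graph n = Fin n → Fin n → Set

IsSimple : ∀ {n} → Graph n → Set
IsSimple {n} G = (∀ u v → G u v → G v u) × (∀ u → ¬ G u u)

_∪edge_,_ : ∀ {n} → Graph n → Fin n → Fin n → Graph n
(G ∪edge u , v) x y = G x y ⊎ ((x ≡ u × y ≡ v) ⊎ (x ≡ v × y ≡ u))

IsClique : ∀ {n} (r : ℕ) → Graph n → (Fin r → Fin n) → Set
IsClique r H f = Injective _≡_ _≡_ f × (∀ i j → i ≢ j → H (f i) (f j))

-- The non-edge uv completes a new copy of K_r in G ∪ {uv}: there is a copy
-- of K_r in G ∪ {uv} containing both u and v (it is new since uv ∉ G).
CompletesKr : ∀ {n} (r : ℕ) → Graph n → Fin n → Fin n → Set
CompletesKr {n} r G u v =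
  u ≢ v × ¬ G u v ×
  Σ (Fin r → Fin n) λ f →
    IsClique r (G ∪edge u , v) f × (∃ λ i → f i ≡ u) × (∃ λ j → f j ≡ v)

step : ∀ {n} (r : ℕ) → Graph n → Graph n
step r G u v = G u v ⊎ CompletesKr r G u v

process : ∀ {n} (r : ℕ) → Graph n → ℕ → Graph n
process r G zero = G
process r G (suc t) = step r (process r G t)

-- G_s ≠ G_{s-1}, for s = suc t: some pair differs.
ChangesAt : ∀ {n} (r : ℕ) → Graph n → ℕ → Set
ChangesAt {n} r G t = Σ (Fin n) λ u → Σ (Fin n) λ v →
  (process r G (suc t) u v × ¬ process r G t u v) ⊎
  (process r G t u v × ¬ process r G (suc t) u v)

StableAt : ∀ {n} (r : ℕ) → Graph n → ℕ → Set
StableAt {n} r G t = ∀ (u v : Fin n) → process r G (suc t) u v ⇔ process r G t u v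

-- The running time: the largest t ≥ 1 with G_t ≠ G_{t-1}, or 0 if none.
RunningTime : ∀ {n} (r : ℕ) → Graph n → ℕ → Set
RunningTime r G zero = ∀ s → StableAt r G s
RunningTime r G (suc t) = ChangesAt r G t × (∀ s → t < s → StableAt r G s)

IsMaxRunningTime : ℕ → ℕ → ℕ → Set₁
IsMaxRunningTime r n m =
  (Σ (Graph n) λ G → IsSimple G × RunningTime r G m) ×
  (∀ (G : Graph n) → IsSimple G → ∀ t → RunningTime r G t → t ≤ m)

module Submission where

-- Coning off (adding an apex joined to every vertex) commutes with one step of the process:
-- a K_{r+1} through two old vertices u, v loses one vertex and becomes a K_r through u and v,
-- namely the apex if it contains it and otherwise any third vertex, which exists as r + 1 ≥ 3.
-- So the cone of an extremal graph for the K_r-process runs exactly as long under the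
-- K_{r+1}-process. The maxima exist constructively: a run adds a fresh edge at each step, so it
-- stops within n² steps, and up to double negation every graph is decidable, hence equivalent
-- to one of the finitely many Boolean adjacency matrices.

open import Defs
open import Data.Bool using (Bool; true; false; T)
open import Data.Empty using (⊥; ⊥-elim)
open import Data.Fin using (Fin; zero; suc; toℕ; punchIn; punchOut; combine; _≟_)
open import Data.Fin.Properties
  using (any?; all?; suc-injective; punchIn-injective; punchInᵢ≢i; punchIn-punchOut; 0≢1+n;
         pigeonhole; combine-injective; toℕ<n)
open import Data.Nat
  using (ℕ; zero; suc; _≤_; _<_; _≥_; _*_; _≤′_; ≤′-refl; ≤′-step; z≤n; s≤s; s≤s⁻¹; _≤?_)
open import Data.Nat.Properties using (≤-antisym; ≰⇒>; ≤⇒≤′; n<1+n; ≤∧≢⇒<) renaming (_≟_ to _≟ℕ_)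
open import Data.Product using (Σ; ∃; ∃₂; _×_; _,_; proj₁; proj₂)
open import Data.Product.Function.NonDependent.Propositional using (_×-⇔_)
open import Data.Sum using (inj₁; inj₂; [_,_])
open import Data.Sum.Function.Propositional using (_⊎-⇔_)
open import Data.Unit using (⊤; tt)
open import Data.Vec.Functional using (Vector; []; _∷_; head; tail)
open import Data.Vec.Functional.Relation.Binary.Pointwise using (Pointwise)
open import Function using (_∘_; id)
open import Function.Bundles using (_⇔_; mk⇔; Equivalence)
open import Function.Definitions using (Injective)
import Function.Properties.Equivalence as ⇔
open import Relation.Binary.Core using (Rel)
open import Relation.Binary.Definitions using (Reflexive; _Respects_)
open import Relation.Binary.PropositionalEquality
  using (_≡_; _≢_; refl; sym; trans; cong; subst; subst₂; ≢-sym)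
open import Relation.Nullary using (¬_; Dec; yes; no; contradiction)
open import Relation.Nullary.Decidable
  using (⌊_⌋; _×-dec_; _⊎-dec_; _→-dec_; ¬?; map′; T?; toWitness; fromWitness;
         decidable-stable; ¬¬-excluded-middle)
open import Relation.Unary using (Pred; Decidable)
open import Level using (0ℓ)
open Equivalence using (to; from)

private
  variable
    n r r′ s t : ℕ

infix 4 _≈ᴳ_ _⊆ᴳ_

_≈ᴳ_ : Graph n → Graph n → Set
G ≈ᴳ H = ∀ u v → G u v ⇔ H u v

_⊆ᴳ_ : Graph n → Graph n → Set
G ⊆ᴳ H = ∀ u v → G u v → H u v

≈ᴳ-sym : {G H : Graph n} → G ≈ᴳ H → H ≈ᴳ G
≈ᴳ-sym G≈H u v = ⇔.sym (G≈H u v)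

≈ᴳ⇒⊆ᴳ : {G H : Graph n} → G ≈ᴳ H → G ⊆ᴳ H
≈ᴳ⇒⊆ᴳ G≈H u v = to (G≈H u v)

isSimple-resp : {G H : Graph n} → G ≈ᴳ H → IsSimple G → IsSimple H
isSimple-resp G≈H (symm , irrefl) =
  (λ u v → to (G≈H v u) ∘ symm u v ∘ from (G≈H u v)) , (λ u → irrefl u ∘ from (G≈H u u))

∪edge-mono : {G H : Graph n} (u v : Fin n) → G ⊆ᴳ H → (G ∪edge u , v) ⊆ᴳ (H ∪edge u , v)
∪edge-mono u v G⊆H x y = [ inj₁ ∘ G⊆H x y , inj₂ ]

CliqueThrough : ∀ r → Graph n → Fin n → Fin n → Vector (Fin n) r → Set
CliqueThrough r H u v f = IsClique r H f × (∃ λ i → f i ≡ u) × (∃ λ j → f j ≡ v)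

cliqueThrough-mono : {G H : Graph n} {u v : Fin n} {f : Vector (Fin n) r} →
                     G ⊆ᴳ H → CliqueThrough r G u v f → CliqueThrough r H u v f
cliqueThrough-mono G⊆H ((inj , adj) , ∋u , ∋v) = (inj , λ i j i≢j → G⊆H _ _ (adj i j i≢j)) , ∋u , ∋v

completesKr-resp : {G H : Graph n} {u v : Fin n} →
                   G ≈ᴳ H → CompletesKr r G u v → CompletesKr r H u v
completesKr-resp {u = u} {v} G≈H (u≢v , ∉G , f , clique) =
  u≢v , ∉G ∘ from (G≈H u v) , f , cliqueThrough-mono (∪edge-mono u v (≈ᴳ⇒⊆ᴳ G≈H)) clique

step-cong : ∀ r {G H : Graph n} → G ≈ᴳ H → step r G ≈ᴳ step r H
step-cong r G≈H u v =
  mk⇔ [ inj₁ ∘ to (G≈H u v) , inj₂ ∘ completesKr-resp G≈H ]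
      [ inj₁ ∘ from (G≈H u v) , inj₂ ∘ completesKr-resp (≈ᴳ-sym G≈H) ]

process-cong : ∀ r {G H : Graph n} → G ≈ᴳ H → ∀ t → process r G t ≈ᴳ process r H t
process-cong r G≈H zero = G≈H
process-cong r G≈H (suc t) = step-cong r (process-cong r G≈H t)

process-mono : ∀ r (G : Graph n) → s ≤ t → process r G s ⊆ᴳ process r G t
process-mono r G = go ∘ ≤⇒≤′
  where
  go : s ≤′ t → process r G s ⊆ᴳ process r G t
  go ≤′-refl u v = id
  go (≤′-step s≤′t) u v = inj₁ ∘ go s≤′t u v

stableAt-mono : ∀ r (G : Graph n) → s ≤ t → StableAt r G s → StableAt r G t
stableAt-mono r G = go ∘ ≤⇒≤′
  where
  go : s ≤′ t → StableAt r G s → StableAt r G t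
  go ≤′-refl = id
  go (≤′-step s≤′t) = step-cong r ∘ go s≤′t

AddedAt : ∀ r → Graph n → ℕ → Fin n → Fin n → Set
AddedAt r G s u v = process r G (suc s) u v × ¬ process r G s u v

changesAt⇒addedAt : ∀ r (G : Graph n) s → ChangesAt r G s → ∃₂ (AddedAt r G s)
changesAt⇒addedAt r G s (u , v , inj₁ added) = u , v , added
changesAt⇒addedAt r G s (u , v , inj₂ (old , ¬new)) = contradiction (inj₁ old) ¬new

addedAt-unique : ∀ r (G : Graph n) {s t} {u v : Fin n} → s < t → AddedAt r G s u v → ¬ AddedAt r G t u v
addedAt-unique r G {u = u} {v} s<t (new , _) (_ , ¬old) = ¬old (process-mono r G s<t u v new)

changesAt⇒¬stableAt : ∀ r (G : Graph n) s → ChangesAt r G s → ¬ StableAt r G s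
changesAt⇒¬stableAt r G s changes stable with changesAt⇒addedAt r G s changes
... | u , v , new , ¬old = ¬old (to (stable u v) new)

-- Distinct steps add distinct edges, so not all of the first n * n + 1 steps can change the graph.
changesAt-bounded : ∀ r (G : Graph n) → ¬ (∀ s → s < suc (n * n) → ChangesAt r G s)
changesAt-bounded {n} r G changes = collision (pigeonhole (n<1+n (n * n)) code)
  where
  added : (i : Fin (suc (n * n))) → ∃₂ (AddedAt r G (toℕ i))
  added i = changesAt⇒addedAt r G (toℕ i) (changes (toℕ i) (toℕ<n i))
  code : Fin (suc (n * n)) → Fin (n * n)
  code i = combine (proj₁ (added i)) (proj₁ (proj₂ (added i)))
  collision : ¬ (∃₂ λ i j → toℕ i < toℕ j × code i ≡ code j)
  collision (i , j , i<j , same) =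
    let u≡ , v≡ = combine-injective _ _ _ _ same
    in addedAt-unique r G {s = toℕ i} {t = toℕ j} i<j (proj₂ (proj₂ (added i)))
         (subst₂ (AddedAt r G (toℕ j)) (sym u≡) (sym v≡) (proj₂ (proj₂ (added j))))

runningTime-stableFrom : ∀ r (G : Graph n) {m} → RunningTime r G m → ∀ s → m ≤ s → StableAt r G s
runningTime-stableFrom r G {zero} stable s _ = stable s
runningTime-stableFrom r G {suc t} (_ , stable) = stable

changesAt⇒<runningTime : ∀ r (G : Graph n) {m} → RunningTime r G m → ChangesAt r G t → t < m
changesAt⇒<runningTime {t = t} r G rt changes =
  ≰⇒> λ m≤t → changesAt⇒¬stableAt r G t changes (runningTime-stableFrom r G rt t m≤t)

runningTime-unique : ∀ r (G : Graph n) {m m′} → RunningTime r G m → RunningTime r G m′ → m ≡ m′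
runningTime-unique r G rt rt′ = ≤-antisym (≤-runningTime rt rt′) (≤-runningTime rt′ rt)
  where
  ≤-runningTime : ∀ {m m′} → RunningTime r G m → RunningTime r G m′ → m ≤ m′
  ≤-runningTime {zero} _ _ = z≤n
  ≤-runningTime {suc t} (changes , _) rt′ = changesAt⇒<runningTime r G rt′ changes

runningTime-intro : ∀ r (G : Graph n) {m} →
                    (∀ s → s < m → ChangesAt r G s) → StableAt r G m → RunningTime r G m
runningTime-intro r G {zero} _ stable s = stableAt-mono {t = s} r G z≤n stable
runningTime-intro r G {suc t} changes stable =
  changes t (n<1+n t) , λ s t<s → stableAt-mono {t = s} r G t<s stable

runningTime-transfer : ∀ {n n′} {G : Graph n} {G′ : Graph n′} →
                       (∀ s → ChangesAt r G s → ChangesAt r′ G′ s) →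
                       (∀ s → StableAt r G s → StableAt r′ G′ s) →
                       ∀ t → RunningTime r G t → RunningTime r′ G′ t
runningTime-transfer changes stable zero rt s = stable s (rt s)
runningTime-transfer changes stable (suc t) (c , rt) = changes t c , λ s t<s → stable s (rt s t<s)

changesAt-transfer : ∀ {n n′} {G : Graph n} {G′ : Graph n′} (φ : Fin n → Fin n′) →
                     (∀ t u v → process r G t u v ⇔ process r′ G′ t (φ u) (φ v)) →
                     ∀ s → ChangesAt r G s → ChangesAt r′ G′ s
changesAt-transfer φ P⇔ s (u , v , inj₁ (new , ¬old)) =
  φ u , φ v , inj₁ (to (P⇔ (suc s) u v) new , ¬old ∘ from (P⇔ s u v))
changesAt-transfer φ P⇔ s (u , v , inj₂ (old , ¬new)) =
  φ u , φ v , inj₂ (to (P⇔ s u v) old , ¬new ∘ from (P⇔ (suc s) u v))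

runningTime-resp : ∀ r {G H : Graph n} → G ≈ᴳ H → ∀ t → RunningTime r G t → RunningTime r H t
runningTime-resp r {G} {H} G≈H = runningTime-transfer (changesAt-transfer id P≈) stable
  where
  P≈ : ∀ t → process r G t ≈ᴳ process r H t
  P≈ = process-cong r G≈H
  stable : ∀ s → StableAt r G s → StableAt r H s
  stable s st u v = ⇔.trans (⇔.sym (P≈ (suc s) u v)) (⇔.trans (st u v) (P≈ s u v))

¬∀<⟶∃¬-smallest : {P : Pred ℕ 0ℓ} → Decidable P → ∀ k → ¬ (∀ s → s < k → P s) →
                   ∃ λ m → m < k × ¬ P m × (∀ s → s < m → P s)
¬∀<⟶∃¬-smallest P? zero ¬all = contradiction (λ _ ()) ¬all
¬∀<⟶∃¬-smallest {P} P? (suc k) ¬all with P? zero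
... | no ¬p₀ = zero , s≤s z≤n , ¬p₀ , λ _ ()
... | yes p₀ =
  let m , m<k , ¬pm , before = ¬∀<⟶∃¬-smallest {P ∘ suc} (P? ∘ suc) k (¬all ∘ extend)
  in suc m , s≤s m<k , ¬pm , extend before
  where
  extend : ∀ {j} → (∀ s → s < j → P (suc s)) → ∀ s → s < suc j → P s
  extend _ zero _ = p₀
  extend all (suc s) (s≤s s<j) = all s s<j

DecGraph : Graph n → Set
DecGraph G = ∀ u v → Dec (G u v)

Searchable : (A : Set) → Rel A 0ℓ → Set₁
Searchable A _≈_ = ∀ {P : Pred A 0ℓ} → P Respects _≈_ → Decidable P → Dec (∃ P)

searchable-Fin : Searchable (Fin n) _≡_
searchable-Fin _ = any?

searchable-Bool : Searchable Bool _≡_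
searchable-Bool _ P? with P? true | P? false
... | yes p | _ = yes (true , p)
... | no _ | yes p = yes (false , p)
... | no ¬t | no ¬f = no λ { (true , p) → ¬t p ; (false , p) → ¬f p }

searchable-Vector : {A : Set} {_≈_ : Rel A 0ℓ} → Reflexive _≈_ → Searchable A _≈_ →
                    ∀ k → Searchable (Vector A k) (Pointwise _≈_)
searchable-Vector ≈-refl search zero resp P? =
  map′ ([] ,_) (λ (f , p) → resp (λ ()) p) (P? [])
searchable-Vector {A} {_≈_} ≈-refl search (suc k) {P} resp P? =
  map′ (λ (x , g , p) → x ∷ g , p) (λ (f , p) → head f , tail f , resp ∷-η p) (search head-resp head?)
  where
  ∷-cong : ∀ {x y} {g h : Vector A k} → x ≈ y → Pointwise _≈_ g h → Pointwise _≈_ (x ∷ g) (y ∷ h)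
  ∷-cong x≈y _ zero = x≈y
  ∷-cong _ g≈h (suc i) = g≈h i
  ∷-η : ∀ {f} → Pointwise _≈_ f (head f ∷ tail f)
  ∷-η zero = ≈-refl
  ∷-η (suc i) = ≈-refl
  head-resp : (λ x → ∃ λ g → P (x ∷ g)) Respects _≈_
  head-resp x≈y (g , p) = g , resp (∷-cong x≈y (λ _ → ≈-refl)) p
  head? : Decidable (λ x → ∃ λ g → P (x ∷ g))
  head? x = searchable-Vector ≈-refl search k (resp ∘ ∷-cong ≈-refl) (P? ∘ (x ∷_))

∪edge? : {G : Graph n} → DecGraph G → ∀ u v → DecGraph (G ∪edge u , v)
∪edge? G? u v x y = G? x y ⊎-dec (((x ≟ u) ×-dec (y ≟ v)) ⊎-dec ((x ≟ v) ×-dec (y ≟ u)))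

isClique? : {H : Graph n} → DecGraph H → ∀ r (f : Vector (Fin n) r) → Dec (IsClique r H f)
isClique? H? r f = injective? ×-dec all? λ i → all? λ j → ¬? (i ≟ j) →-dec H? (f i) (f j)
  where
  injective? : Dec (Injective _≡_ _≡_ f)
  injective? = map′ (λ inj {x} {y} → inj x y) (λ inj x y → inj)
                    (all? λ x → all? λ y → (f x ≟ f y) →-dec (x ≟ y))

cliqueThrough-resp : ∀ {H : Graph n} {u v} → CliqueThrough r H u v Respects Pointwise _≡_
cliqueThrough-resp {H = H} f≗g ((inj , adj) , (i , fi≡u) , (j , fj≡v)) =
  ((λ {x} {y} gx≡gy → inj (trans (f≗g x) (trans gx≡gy (sym (f≗g y))))) ,
   λ a b a≢b → subst₂ H (f≗g a) (f≗g b) (adj a b a≢b)) ,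
  (i , trans (sym (f≗g i)) fi≡u) , (j , trans (sym (f≗g j)) fj≡v)

completesKr? : {G : Graph n} → DecGraph G → ∀ r → DecGraph (CompletesKr r G)
completesKr? {G = G} G? r u v =
  ¬? (u ≟ v) ×-dec ¬? (G? u v) ×-dec
  searchable-Vector refl searchable-Fin r (cliqueThrough-resp {H = G ∪edge u , v}) λ f →
    isClique? (∪edge? G? u v) r f ×-dec (any? (λ i → f i ≟ u) ×-dec any? (λ j → f j ≟ v))

process? : {G : Graph n} → DecGraph G → ∀ r t → DecGraph (process r G t)
process? G? r zero = G?
process? G? r (suc t) u v = process? G? r t u v ⊎-dec completesKr? (process? G? r t) r u v

module _ (r : ℕ) {G : Graph n} (G? : DecGraph G) where

  changesAt? : Decidable (ChangesAt r G)
  changesAt? s = any? λ u → any? λ v →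
    (process? G? r (suc s) u v ×-dec ¬? (process? G? r s u v)) ⊎-dec
    (process? G? r s u v ×-dec ¬? (process? G? r (suc s) u v))

  ¬changesAt⇒stableAt : ∀ s → ¬ ChangesAt r G s → StableAt r G s
  ¬changesAt⇒stableAt s ¬changes u v =
    mk⇔ (λ new → decidable-stable (process? G? r s u v) λ ¬old → ¬changes (u , v , inj₁ (new , ¬old)))
        inj₁

  runningTime-exists : ∃ λ m → RunningTime r G m × m ≤ n * n
  runningTime-exists with ¬∀<⟶∃¬-smallest changesAt? (suc (n * n)) (changesAt-bounded r G)
  ... | m , s≤s m≤n² , ¬changes , before =
    m , runningTime-intro r G before (¬changesAt⇒stableAt m ¬changes) , m≤n²

  runningTime? : Decidable (RunningTime r G)
  runningTime? t =
    let m , rt , _ = runningTime-exists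
    in map′ (λ { refl → rt }) (λ rt′ → runningTime-unique r G rt′ rt) (t ≟ℕ m)

  runningTime-bounded : ∀ t → RunningTime r G t → t ≤ n * n
  runningTime-bounded t rt =
    let m , rt′ , m≤n² = runningTime-exists
    in subst (_≤ n * n) (runningTime-unique r G rt′ rt) m≤n²

isSimple? : {G : Graph n} → DecGraph G → Dec (IsSimple G)
isSimple? G? = all? (λ u → all? λ v → G? u v →-dec G? v u) ×-dec all? (λ u → ¬? (G? u u))

¬¬-∀-Fin : ∀ {k} {P : Pred (Fin k) 0ℓ} → (∀ i → ¬ ¬ P i) → ¬ ¬ (∀ i → P i)
¬¬-∀-Fin {zero} _ ¬all = ¬all λ ()
¬¬-∀-Fin {suc k} ¬¬P ¬all =
  ¬¬P zero λ p₀ → ¬¬-∀-Fin (¬¬P ∘ suc) λ ps → ¬all λ { zero → p₀ ; (suc i) → ps i }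

¬¬-decGraph : (G : Graph n) → ¬ ¬ DecGraph G
¬¬-decGraph G = ¬¬-∀-Fin λ u → ¬¬-∀-Fin λ v → ¬¬-excluded-middle

Code : ℕ → Set
Code n = Vector (Vector Bool n) n

⟦_⟧ : Code n → Graph n
⟦ c ⟧ u v = T (c u v)

⟦_⟧? : (c : Code n) → DecGraph ⟦ c ⟧
⟦ c ⟧? u v = T? (c u v)

⟦⟧-cong : {c d : Code n} → Pointwise (Pointwise _≡_) c d → ⟦ c ⟧ ≈ᴳ ⟦ d ⟧
⟦⟧-cong c≈d u v = subst (λ b → _ ⇔ T b) (c≈d u v) ⇔.refl

encode : {G : Graph n} → DecGraph G → Code n
encode G? u v = ⌊ G? u v ⌋

encode-≈ᴳ : {G : Graph n} (G? : DecGraph G) → G ≈ᴳ ⟦ encode G? ⟧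
encode-≈ᴳ G? u v = mk⇔ fromWitness toWitness

∃≤⟶∃-largest : {P : Pred ℕ 0ℓ} → Decidable P → ∀ N {k} → P k × k ≤ N →
               ∃ λ m → P m × (∀ {k} → P k × k ≤ N → k ≤ m)
∃≤⟶∃-largest P? zero (pk , z≤n) = zero , pk , proj₂
∃≤⟶∃-largest {P} P? (suc N) (pk , k≤1+N) with P? (suc N)
... | yes pN = suc N , pN , proj₂
... | no ¬pN =
  let m , pm , maximal = ∃≤⟶∃-largest P? N (pk , below pk k≤1+N)
  in m , pm , λ (pk′ , k′≤1+N) → maximal (pk′ , below pk′ k′≤1+N)
  where
  below : ∀ {k} → P k → k ≤ suc N → k ≤ N
  below pk k≤1+N = s≤s⁻¹ (≤∧≢⇒< k≤1+N λ { refl → ¬pN pk })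

maxRunningTime-exists : ∀ r n → ∃ (IsMaxRunningTime r n)
maxRunningTime-exists r n =
  let m₀ , rt₀ , _ = runningTime-exists r ⟦ empty ⟧?
      m , (c , simple , rt) , maximal =
        ∃≤⟶∃-largest realised? (n * n) (realisable ⟦ empty ⟧? empty-simple m₀ rt₀)
  in m , (⟦ c ⟧ , simple , rt) , λ G simpleG t rtG →
       decidable-stable (t ≤? m) λ t≰m → ¬¬-decGraph G λ G? → t≰m (maximal (realisable G? simpleG t rtG))
  where
  Realised : ℕ → Code n → Set
  Realised m c = IsSimple ⟦ c ⟧ × RunningTime r ⟦ c ⟧ m
  realised? : Decidable (λ m → ∃ (Realised m))
  realised? m =
    searchable-Vector (λ _ → refl) (searchable-Vector refl searchable-Bool n) n
      (λ c≈d (simple , rt) → isSimple-resp (⟦⟧-cong c≈d) simple , runningTime-resp r (⟦⟧-cong c≈d) m rt)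
      (λ c → isSimple? ⟦ c ⟧? ×-dec runningTime? r ⟦ c ⟧? m)
  realisable : {G : Graph n} → DecGraph G → IsSimple G → ∀ t → RunningTime r G t →
               ∃ (Realised t) × t ≤ n * n
  realisable G? simple t rt =
    (encode G? , isSimple-resp (encode-≈ᴳ G?) simple , runningTime-resp r (encode-≈ᴳ G?) t rt) ,
    runningTime-bounded r G? t rt
  empty : Code n
  empty _ _ = false
  empty-simple : IsSimple ⟦ empty ⟧
  empty-simple = (λ _ _ ()) , (λ _ ())

cone : Graph n → Graph (suc n)
cone G zero zero = ⊥
cone G zero (suc _) = ⊤
cone G (suc _) zero = ⊤
cone G (suc u) (suc v) = G u v

cone-simple : {G : Graph n} → IsSimple G → IsSimple (cone G)
cone-simple {G = G} (symm , irrefl) = symm′ , irrefl′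
  where
  symm′ : ∀ u v → cone G u v → cone G v u
  symm′ zero zero = id
  symm′ zero (suc _) _ = tt
  symm′ (suc _) zero _ = tt
  symm′ (suc u) (suc v) = symm u v
  irrefl′ : ∀ u → ¬ cone G u u
  irrefl′ zero = id
  irrefl′ (suc u) = irrefl u

cone-cong : {G H : Graph n} → G ≈ᴳ H → cone G ≈ᴳ cone H
cone-cong G≈H zero zero = ⇔.refl
cone-cong G≈H zero (suc _) = ⇔.refl
cone-cong G≈H (suc _) zero = ⇔.refl
cone-cong G≈H (suc u) (suc v) = G≈H u v

suc-≡⇔ : {a b : Fin n} → suc a ≡ suc b ⇔ a ≡ b
suc-≡⇔ = mk⇔ suc-injective (cong suc)

cone-∪edge : (H : Graph n) (u v : Fin n) → (cone H ∪edge suc u , suc v) ≈ᴳ cone (H ∪edge u , v)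
cone-∪edge H u v zero zero = mk⇔ [ id , [ (λ ()) ∘ proj₁ , (λ ()) ∘ proj₁ ] ] ⊥-elim
cone-∪edge H u v zero (suc _) = mk⇔ _ inj₁
cone-∪edge H u v (suc _) zero = mk⇔ _ inj₁
cone-∪edge H u v (suc _) (suc _) = ⇔.refl ⊎-⇔ (suc-≡⇔ ×-⇔ suc-≡⇔) ⊎-⇔ (suc-≡⇔ ×-⇔ suc-≡⇔)

cliqueThrough-cone : {K : Graph n} {u v : Fin n} {f : Vector (Fin n) r} →
                     CliqueThrough r K u v f →
                     CliqueThrough (suc r) (cone K) (suc u) (suc v) (zero ∷ suc ∘ f)
cliqueThrough-cone {K = K} {f = f} ((inj , adj) , (i , fi≡u) , (j , fj≡v)) =
  (inj′ , adj′) , (suc i , cong suc fi≡u) , (suc j , cong suc fj≡v)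
  where
  inj′ : Injective _≡_ _≡_ (zero ∷ suc ∘ f)
  inj′ {zero} {zero} _ = refl
  inj′ {suc x} {suc y} fx≡fy = cong suc (inj (suc-injective fx≡fy))
  adj′ : ∀ a b → a ≢ b → cone K ((zero ∷ suc ∘ f) a) ((zero ∷ suc ∘ f) b)
  adj′ zero zero a≢b = contradiction refl a≢b
  adj′ zero (suc _) _ = tt
  adj′ (suc _) zero _ = tt
  adj′ (suc a) (suc b) a≢b = adj a b (a≢b ∘ cong suc)

cliqueThrough-delete : {K : Graph n} {u v : Fin n} {f : Vector (Fin (suc n)) (suc r)} →
                       CliqueThrough (suc r) (cone K) (suc u) (suc v) f →
                       ∀ k → (∀ l → l ≢ k → f l ≢ zero) → f k ≢ suc u → f k ≢ suc v →
                       ∃ (CliqueThrough r K u v)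
cliqueThrough-delete {K = K} {f = f} ((inj , adj) , (i , fi≡u) , (j , fj≡v)) k off-apex fk≢u fk≢v =
  g , (inj′ , adj′) , (punchOut k≢i , through k≢i fi≡u) , (punchOut k≢j , through k≢j fj≡v)
  where
  k≢i : k ≢ i
  k≢i refl = fk≢u fi≡u
  k≢j : k ≢ j
  k≢j refl = fk≢v fj≡v
  apex≢ : ∀ l → zero ≢ f (punchIn k l)
  apex≢ l = ≢-sym (off-apex (punchIn k l) (punchInᵢ≢i k l))
  g : Vector (Fin _) _
  g l = punchOut (apex≢ l)
  suc-g : ∀ l → suc (g l) ≡ f (punchIn k l)
  suc-g l = punchIn-punchOut (apex≢ l)
  inj′ : Injective _≡_ _≡_ g
  inj′ {x} {y} gx≡gy =
    punchIn-injective k x y (inj (trans (sym (suc-g x)) (trans (cong suc gx≡gy) (suc-g y))))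
  adj′ : ∀ a b → a ≢ b → K (g a) (g b)
  adj′ a b a≢b =
    subst₂ (cone K) (sym (suc-g a)) (sym (suc-g b))
      (adj (punchIn k a) (punchIn k b) (a≢b ∘ punchIn-injective k a b))
  through : ∀ {i w} (k≢i : k ≢ i) → f i ≡ suc w → g (punchOut k≢i) ≡ w
  through k≢i fi≡w = suc-injective (trans (suc-g _) (trans (cong f (punchIn-punchOut k≢i)) fi≡w))

third : ∀ {m} (i j : Fin (suc (suc (suc m)))) → ∃ λ k → k ≢ i × k ≢ j
third zero zero = suc zero , (λ ()) , (λ ())
third zero (suc zero) = suc (suc zero) , (λ ()) , (λ ())
third zero (suc (suc _)) = suc zero , (λ ()) , (λ ())
third (suc zero) zero = suc (suc zero) , (λ ()) , (λ ())
third (suc (suc _)) zero = suc zero , (λ ()) , (λ ())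
third (suc _) (suc _) = zero , (λ ()) , (λ ())

cliqueThrough-uncone : {K : Graph n} {u v : Fin n} {f : Vector (Fin (suc n)) (suc r)} → r ≥ 2 →
                       CliqueThrough (suc r) (cone K) (suc u) (suc v) f → ∃ (CliqueThrough r K u v)
cliqueThrough-uncone {f = f} (s≤s (s≤s z≤n)) clique@((inj , _) , (i , fi≡u) , (j , fj≡v))
  with any? (λ k → f k ≟ zero)
... | yes (k , fk≡0) =
  cliqueThrough-delete clique k (λ l l≢k fl≡0 → l≢k (inj (trans fl≡0 (sym fk≡0))))
    (0≢1+n ∘ trans (sym fk≡0)) (0≢1+n ∘ trans (sym fk≡0))
... | no off-apex =
  let k , k≢i , k≢j = third i j
  in cliqueThrough-delete clique k (λ l _ fl≡0 → off-apex (l , fl≡0))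
       (λ fk≡u → k≢i (inj (trans fk≡u (sym fi≡u)))) (λ fk≡v → k≢j (inj (trans fk≡v (sym fj≡v))))

completesKr-cone : r ≥ 2 → (H : Graph n) (u v : Fin n) →
                   CompletesKr (suc r) (cone H) (suc u) (suc v) ⇔ CompletesKr r H u v
completesKr-cone r≥2 H u v = mk⇔
  (λ (u≢v , ∉H , _ , clique) →
     u≢v ∘ cong suc , ∉H ,
     cliqueThrough-uncone r≥2 (cliqueThrough-mono (≈ᴳ⇒⊆ᴳ (cone-∪edge H u v)) clique))
  (λ (u≢v , ∉H , _ , clique) →
     u≢v ∘ suc-injective , ∉H , _ ,
     cliqueThrough-mono (≈ᴳ⇒⊆ᴳ (≈ᴳ-sym (cone-∪edge H u v))) (cliqueThrough-cone clique))

step-cone : r ≥ 2 → (H : Graph n) → step (suc r) (cone H) ≈ᴳ cone (step r H)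
step-cone r≥2 H zero zero = mk⇔ [ id , (λ completes → proj₁ completes refl) ] ⊥-elim
step-cone r≥2 H zero (suc _) = mk⇔ _ inj₁
step-cone r≥2 H (suc _) zero = mk⇔ _ inj₁
step-cone r≥2 H (suc u) (suc v) = ⇔.refl ⊎-⇔ completesKr-cone r≥2 H u v

process-cone : r ≥ 2 → (G : Graph n) → ∀ t → process (suc r) (cone G) t ≈ᴳ cone (process r G t)
process-cone r≥2 G zero u v = ⇔.refl
process-cone {r = r} r≥2 G (suc t) u v =
  ⇔.trans (step-cong (suc r) (process-cone r≥2 G t) u v) (step-cone r≥2 (process r G t) u v)

runningTime-cone : r ≥ 2 → (G : Graph n) → ∀ t → RunningTime r G t → RunningTime (suc r) (cone G) t
runningTime-cone {r = r} r≥2 G =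
  runningTime-transfer (changesAt-transfer suc λ t u v → ⇔.sym (P≈ t (suc u) (suc v))) stable
  where
  P≈ : ∀ t → process (suc r) (cone G) t ≈ᴳ cone (process r G t)
  P≈ = process-cone r≥2 G
  stable : ∀ s → StableAt r G s → StableAt (suc r) (cone G) s
  stable s st u v = ⇔.trans (P≈ (suc s) u v) (⇔.trans (cone-cong st u v) (⇔.sym (P≈ s u v)))

-- The hypothesis n ≥ 1 is unused: the cone construction works for n = 0 as well.
mainTheorem5 : ∀ (r n : ℕ) → r ≥ 2 → n ≥ 1 →
    Σ ℕ λ m → Σ ℕ λ m′ →
      IsMaxRunningTime r n m × IsMaxRunningTime (suc r) (suc n) m′ × m ≤ m′
mainTheorem5 r n r≥2 _ =
  let m , max@((G , simple , rt) , _) = maxRunningTime-exists r n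
      m′ , max′@(_ , maximal′) = maxRunningTime-exists (suc r) (suc n)
  in m , m′ , max , max′ , maximal′ (cone G) (cone-simple simple) m (runningTime-cone r≥2 G m rt)
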